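{- Let $G$ and $H$ be finite simple undirected graphs and $k=\min\{\chi(G),\chi(H)\}$. Then $$\chi_o^+(G\,\square\,H)\le k\,\chi_o^+(G)\,\chi_o^+(H).$$
   Context: An oriented graph is a digraph with no loops, no multiple arcs and no pair of opposite arcs; an orientation of an undirected graph gives each edge one of its two directions. A homomorphism between oriented graphs is a vertex map sending arcs to arcs. The upper oriented chromatic number $\chi_o^+(G)$ is the smallest order of an oriented graph $\vec T$ such that every orientation of $G$ admits a homomorphism to $\vec T$. $\chi$ is the chromatic number. The Cartesian product $G\,\square\,H$ has vertex set $V(G)\times V(H)$, and $\{[u,v],[u',v']\}$ is an edge iff either $u=u'$ and $\{v,v'\}\in E(H)$, or $v=v'$ and $\{u,u'\}\in E(G)$. -}

module Defs where

open import Data.Nat using (ℕ; _<_; _≤_)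
open import Data.Nat using (_*_)
open import Data.Fin using (Fin; remQuot; _≟_)
open import Relation.Nullary using (does; yes; no)
open import Data.Empty using (⊥-elim)
open import Data.Bool using (Bool; true; false; _∧_; _∨_)
open import Data.Product using (Σ; _×_; _,_; proj₁; proj₂)
open import Relation.Binary.PropositionalEquality using (_≡_; refl) renaming (sym to ≡sym)
open import Relation.Nullary using (¬_)

record Graph : Set where
  field
    n     : ℕ
    adj   : Fin n → Fin n → Bool
    sym   : ∀ u v → adj u v ≡ adj v u
    irrefl : ∀ u → adj u u ≡ false
open Graph public

-- An oriented graph on Fin m: no loops, no pair of opposite arcs
-- (multiple arcs are impossible with a Boolean arc relation).
record OrientedGraph (m : ℕ) : Set where
  field
    arc      : Fin m → Fin m → Bool
    loopless : ∀ u → arc u u ≡ false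
    noOpp    : ∀ u v → arc u v ≡ true → arc v u ≡ false
open OrientedGraph public

record Orientation (G : Graph) : Set where
  field
    dir      : Fin (n G) → Fin (n G) → Bool
    onEdges  : ∀ u v → dir u v ≡ true → adj G u v ≡ true
    covers   : ∀ u v → adj G u v ≡ true → (dir u v ∨ dir v u) ≡ true
    oneWay   : ∀ u v → dir u v ≡ true → dir v u ≡ false
open Orientation public

Hom : {G : Graph} {m : ℕ} → Orientation G → OrientedGraph m → Set
Hom {G} {m} O T =
  Σ (Fin (n G) → Fin m) λ f →
    ∀ u v → dir O u v ≡ true → arc T (f u) (f v) ≡ true

OUniversal : Graph → ℕ → Set
OUniversal G m = Σ (OrientedGraph m) λ T → (O : Orientation G) → Hom O T

IsUpperOChromaticNumber : Graph → ℕ → Set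
IsUpperOChromaticNumber G m = OUniversal G m × (∀ m′ → m′ < m → ¬ OUniversal G m′)

Colourable : Graph → ℕ → Set
Colourable G k =
  Σ (Fin (n G) → Fin k) λ c → ∀ u v → adj G u v ≡ true → ¬ (c u ≡ c v)

IsChromaticNumber : Graph → ℕ → Set
IsChromaticNumber G k = Colourable G k × (∀ k′ → k′ < k → ¬ Colourable G k′)

-- Cartesian product G □ H, on vertex set Fin (n G * n H), identified with
-- Fin (n G) × Fin (n H) via the bijection Data.Fin.remQuot / combine.
-- [u,v] ~ [u',v']  iff  (u = u' and v ~_H v')  or  (v = v' and u ~_G u').
eqF : ∀ {k} → Fin k → Fin k → Bool
eqF a b = does (a ≟ b)

eqF-sym : ∀ {k} (a b : Fin k) → eqF a b ≡ eqF b a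
eqF-sym a b with a ≟ b | b ≟ a
... | yes _ | yes _ = refl
... | no _  | no _  = refl
... | yes p | no ¬q = ⊥-elim (¬q (≡sym p))
... | no ¬p | yes q = ⊥-elim (¬p (≡sym q))

eqF-refl : ∀ {k} (a : Fin k) → eqF a a ≡ true
eqF-refl a with a ≟ a
... | yes _ = refl
... | no ¬p = ⊥-elim (¬p refl)

pairAdj : (G H : Graph) → Fin (n G) × Fin (n H) → Fin (n G) × Fin (n H) → Bool
pairAdj G H (u , v) (u′ , v′) = (eqF u u′ ∧ adj H v v′) ∨ (eqF v v′ ∧ adj G u u′)

_□_ : Graph → Graph → Graph
G □ H = record
  { n = n G * n H
  ; adj = λ i j → pairAdj G H (remQuot {n G} (n H) i) (remQuot {n G} (n H) j)
  ; sym = λ i j → psym (remQuot {n G} (n H) i) (remQuot {n G} (n H) j)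
  ; irrefl = λ i → pirr (remQuot {n G} (n H) i)
  }
  where
    psym : ∀ p q → pairAdj G H p q ≡ pairAdj G H q p
    psym (u , v) (u′ , v′)
      rewrite eqF-sym u u′ | eqF-sym v v′ | Graph.sym H v v′ | Graph.sym G u u′ = refl
    pirr : ∀ p → pairAdj G H p p ≡ false
    pirr (u , v) rewrite eqF-refl u | eqF-refl v | Graph.irrefl H v | Graph.irrefl G u = refl

-- Fix a proper k-colouring c of G, and oriented graphs T_G, T_H that are
-- universal for the orientations of G and of H. An orientation of G □ H
-- restricts on each fibre G × {v} to an orientation of G and on each fibre
-- {u} × H to an orientation of H; let f_v : G → T_G and g_u : H → T_H be
-- homomorphisms of these. Send [u,v] to (c u, f_v u, g_u v) in the oriented
-- graph on [k] × T_G × T_H whose arcs are those of T_H between equal colours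
-- and those of T_G between distinct colours. An arc inside {u} × H keeps the
-- colour and is carried by g_u; an arc inside G × {v} changes the colour,
-- since c is proper, and is carried by f_v. Exchanging G and H gives the
-- bound with χ(H) in place of χ(G).
module Submission where

open import Defs
open import Data.Nat using (ℕ; _≤_; _*_; _⊓_)
open import Data.Nat.Properties using (≮⇒≥; ⊓-sel; *-commutativeSemigroup)
open import Algebra.Properties.CommutativeSemigroup *-commutativeSemigroup using (xy∙z≈xz∙y)
open import Data.Fin using (Fin; remQuot; combine; _≟_)
open import Data.Fin.Properties using (remQuot-combine; combine-remQuot)
open import Data.Bool using (Bool; true; false; _∧_; _∨_; if_then_else_)
open import Data.Bool.Properties using (∨-comm; ∧-zeroʳ)
open import Data.Product using (Σ; _×_; _,_; proj₁; proj₂; uncurry; swap; map₁; assocʳ′)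
open import Data.Sum using (_⊎_; inj₁; inj₂)
open import Relation.Nullary using (yes)
open import Relation.Nullary.Decidable using (dec-false)
open import Relation.Binary.PropositionalEquality
  using (_≡_; refl; cong; cong₂; subst; trans) renaming (sym to ≡sym)

private
  variable
    a b k m : ℕ
    G H : Graph

∨-true : ∀ x y → (x ∨ y) ≡ true → x ≡ true ⊎ y ≡ true
∨-true true  _ _ = inj₁ refl
∨-true false _ p = inj₂ p

∧-true : ∀ x y → (x ∧ y) ≡ true → x ≡ true × y ≡ true
∧-true true _ p = refl , p

eqF-true⇒≡ : (i j : Fin k) → eqF i j ≡ true → i ≡ j
eqF-true⇒≡ i j p with i ≟ j
... | yes i≡j = i≡j

minimal-universal : IsUpperOChromaticNumber G m → OUniversal G a → m ≤ a
minimal-universal (_ , minimal) universal = ≮⇒≥ λ a<m → minimal _ a<m universal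

data CartesianEdge (G H : Graph) : (p q : Fin (n G) × Fin (n H)) → Set where
  alongH : ∀ {u v v′} → adj H v v′ ≡ true → CartesianEdge G H (u , v) (u , v′)
  alongG : ∀ {u u′ v} → adj G u u′ ≡ true → CartesianEdge G H (u , v) (u′ , v)

pairAdj⇒cartesianEdge : {G H : Graph} (p q : Fin (n G) × Fin (n H)) →
  pairAdj G H p q ≡ true → CartesianEdge G H p q
pairAdj⇒cartesianEdge {G} {H} (u , v) (u′ , v′) e
  with ∨-true (eqF u u′ ∧ adj H v v′) (eqF v v′ ∧ adj G u u′) e
... | inj₁ e′ with ∧-true (eqF u u′) _ e′
...   | u≡u′ , vv′ with refl ← eqF-true⇒≡ u u′ u≡u′ = alongH vv′
pairAdj⇒cartesianEdge (u , v) (u′ , v′) e | inj₂ e′ with ∧-true (eqF v v′) _ e′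
...   | v≡v′ , uu′ with refl ← eqF-true⇒≡ v v′ v≡v′ = alongG uu′

pairAdj-fibre : {G H : Graph} → ∀ u u′ (v : Fin (n H)) → pairAdj G H (u , v) (u′ , v) ≡ adj G u u′
pairAdj-fibre {H = H} u u′ v
  rewrite Graph.irrefl H v | eqF-refl v | ∧-zeroʳ (eqF u u′) = refl

pairAdj-swap : {G H : Graph} (p q : Fin (n G) × Fin (n H)) →
  pairAdj H G (swap p) (swap q) ≡ pairAdj G H p q
pairAdj-swap {G} {H} (u , v) (u′ , v′) =
  ∨-comm (eqF v v′ ∧ adj G u u′) (eqF u u′ ∧ adj H v v′)

record PairOrientation (G H : Graph) : Set where
  field
    dir     : Fin (n G) × Fin (n H) → Fin (n G) × Fin (n H) → Bool
    onEdges : ∀ p q → dir p q ≡ true → pairAdj G H p q ≡ true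
    covers  : ∀ p q → pairAdj G H p q ≡ true → (dir p q ∨ dir q p) ≡ true
    oneWay  : ∀ p q → dir p q ≡ true → dir q p ≡ false
open PairOrientation

PairHom : PairOrientation G H → OrientedGraph m → Set
PairHom {G} {H} {m} D T =
  Σ (Fin (n G) × Fin (n H) → Fin m) λ f →
    ∀ p q → dir D p q ≡ true → arc T (f p) (f q) ≡ true

toPairOrientation : Orientation (G □ H) → PairOrientation G H
toPairOrientation {G} {H} O = record
  { dir     = λ p q → Orientation.dir O (combine′ p) (combine′ q)
  ; onEdges = λ p q e → trans (adj-combine p q) (Orientation.onEdges O _ _ e)
  ; covers  = λ p q e → Orientation.covers O _ _ (trans (≡sym (adj-combine p q)) e)
  ; oneWay  = λ p q → Orientation.oneWay O _ _
  }
  where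
  combine′ : Fin (n G) × Fin (n H) → Fin (n G * n H)
  combine′ = uncurry combine
  adj-combine : ∀ p q → pairAdj G H p q ≡ adj (G □ H) (combine′ p) (combine′ q)
  adj-combine (u , v) (u′ , v′) = ≡sym (cong₂ (pairAdj G H)
    (remQuot-combine {n G} {n H} u v) (remQuot-combine {n G} {n H} u′ v′))

pairHom⇒hom : (O : Orientation (G □ H)) (T : OrientedGraph m) →
  PairHom (toPairOrientation O) T → Hom O T
pairHom⇒hom {G} {H} O _ (f , f-hom) =
  (λ i → f (remQuot′ i)) ,
  λ i j e → f-hom _ _ (subst (_≡ true)
    (≡sym (cong₂ (Orientation.dir O) (combine-remQuot {n G} (n H) i) (combine-remQuot {n G} (n H) j))) e)
  where
  remQuot′ : Fin (n G * n H) → Fin (n G) × Fin (n H)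
  remQuot′ = remQuot {n G} (n H)

swapOrientation : PairOrientation G H → PairOrientation H G
swapOrientation {G} {H} D = record
  { dir     = λ p q → dir D (swap p) (swap q)
  ; onEdges = λ p q e → trans (≡sym (pairAdj-swap {H} {G} p q)) (onEdges D _ _ e)
  ; covers  = λ p q e → covers D _ _ (trans (pairAdj-swap {H} {G} p q) e)
  ; oneWay  = λ p q → oneWay D _ _
  }

swapPairHom : (D : PairOrientation G H) (T : OrientedGraph m) →
  PairHom (swapOrientation D) T → PairHom D T
swapPairHom D _ (f , f-hom) = (λ p → f (swap p)) , λ p q → f-hom (swap p) (swap q)

fibre : PairOrientation G H → Fin (n H) → Orientation G
fibre {G} {H} D v = record
  { dir     = λ u u′ → dir D (u , v) (u′ , v)
  ; onEdges = λ u u′ e → trans (≡sym (pairAdj-fibre {G} {H} u u′ v)) (onEdges D _ _ e)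
  ; covers  = λ u u′ e → covers D _ _ (trans (pairAdj-fibre {G} {H} u u′ v) e)
  ; oneWay  = λ u u′ → oneWay D _ _
  }

module Layered (k : ℕ) (TA : OrientedGraph a) (TB : OrientedGraph b) where

  Triple : Set
  Triple = Fin k × Fin a × Fin b

  layerArc : Triple → Triple → Bool
  layerArc (i , x , y) (j , x′ , y′) = if eqF i j then arc TB y y′ else arc TA x x′

  layerArc-loopless : ∀ t → layerArc t t ≡ false
  layerArc-loopless (i , x , y) rewrite eqF-refl i = loopless TB y

  layerArc-noOpp : ∀ s t → layerArc s t ≡ true → layerArc t s ≡ false
  layerArc-noOpp (i , x , y) (j , x′ , y′) e rewrite eqF-sym j i with eqF i j
  ... | true  = noOpp TB y y′ e
  ... | false = noOpp TA x x′ e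

  decode : Fin (k * a * b) → Triple
  decode t = assocʳ′ (map₁ (remQuot {k} a) (remQuot {k * a} b t))

  encode : Triple → Fin (k * a * b)
  encode (i , x , y) = combine (combine i x) y

  decode-encode : ∀ t → decode (encode t) ≡ t
  decode-encode (i , x , y) = cong assocʳ′ (trans
    (cong (map₁ (remQuot {k} a)) (remQuot-combine {k * a} (combine i x) y))
    (cong (_, y) (remQuot-combine {k} i x)))

  layered : OrientedGraph (k * a * b)
  layered = record
    { arc      = λ s t → layerArc (decode s) (decode t)
    ; loopless = λ t → layerArc-loopless (decode t)
    ; noOpp    = λ s t → layerArc-noOpp (decode s) (decode t)
    }

  arc-layered-encode : ∀ s t → arc layered (encode s) (encode t) ≡ layerArc s t
  arc-layered-encode s t = cong₂ layerArc (decode-encode s) (decode-encode t)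

module _ (TG : OrientedGraph a) (TH : OrientedGraph b)
  (colouring : Colourable G k)
  (homG : (O : Orientation G) → Hom O TG) (homH : (O : Orientation H) → Hom O TH)
  where
  open Layered k TG TH

  layered-pairHom : (D : PairOrientation G H) → PairHom D layered
  layered-pairHom D = (λ p → encode (h p)) ,
    λ p q e → trans (arc-layered-encode (h p) (h q))
      (h-hom p q e (pairAdj⇒cartesianEdge {G} {H} p q (onEdges D p q e)))
    where
    c : Fin (n G) → Fin k
    c = proj₁ colouring
    f : Fin (n H) → Fin (n G) → Fin a
    f v = proj₁ (homG (fibre D v))
    g : Fin (n G) → Fin (n H) → Fin b
    g u = proj₁ (homH (fibre (swapOrientation D) u))

    h : Fin (n G) × Fin (n H) → Triple
    h (u , v) = c u , f v u , g u v

    h-hom : ∀ p q → dir D p q ≡ true → CartesianEdge G H p q → layerArc (h p) (h q) ≡ true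
    h-hom (u , v) (u , v′) e (alongH _) rewrite eqF-refl (c u) =
      proj₂ (homH (fibre (swapOrientation D) u)) v v′ e
    h-hom (u , v) (u′ , v) e (alongG uu′)
      rewrite dec-false (c u ≟ c u′) (proj₂ colouring u u′ uu′) =
      proj₂ (homG (fibre D v)) u u′ e

□-universalˡ : Colourable G k → OUniversal G a → OUniversal H b → OUniversal (G □ H) (k * a * b)
□-universalˡ {k = k} {a = a} {b = b} colouring (TG , homG) (TH , homH) = T ,
  λ O → pairHom⇒hom O T (layered-pairHom TG TH colouring homG homH (toPairOrientation O))
  where
  T : OrientedGraph (k * a * b)
  T = Layered.layered k TG TH

□-universalʳ : Colourable H k → OUniversal G a → OUniversal H b → OUniversal (G □ H) (k * a * b)
□-universalʳ {k = k} {a = a} {b = b} colouring (TG , homG) (TH , homH) =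
  subst (OUniversal _) (xy∙z≈xz∙y k b a) (T ,
    λ O → let D = toPairOrientation O in pairHom⇒hom O T (swapPairHom D T
      (layered-pairHom TH TG colouring homH homG (swapOrientation D))))
  where
  T : OrientedGraph (k * b * a)
  T = Layered.layered k TH TG

theorem12 : (G H : Graph) (χG χH oG oH oGH : ℕ)
    → IsChromaticNumber G χG → IsChromaticNumber H χH
    → IsUpperOChromaticNumber G oG → IsUpperOChromaticNumber H oH
    → IsUpperOChromaticNumber (G □ H) oGH
    → oGH ≤ (χG ⊓ χH) * oG * oH
theorem12 G H χG χH oG oH oGH (colG , _) (colH , _) (univG , _) (univH , _) oGH-min
  with ⊓-sel χG χH
... | inj₁ eq rewrite eq = minimal-universal oGH-min (□-universalˡ colG univG univH)
... | inj₂ eq rewrite eq = minimal-universal oGH-min (□-universalʳ colH univG univH)
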